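{- Let $m$ be an odd positive integer, $1\le d\le\frac{m-1}{2}$, and $\beta=(b_1,\dots,b_{2d})\in\mathfrak B_m^d$. Then $b_d<\frac m2$ and $b_{d+1}>\frac m2$.
   Context: $\mathfrak B_m^d$ is the set of tuples $(b_1,\dots,b_{2d})$ of integers with (1) $1\le b_1<\cdots<b_{2d}\le m-1$; (2) $\sum_i b_i\equiv0\pmod m$; (3) $\sum_{i=1}^{2d}\langle tb_i\rangle_m/m=d$ for all $t\in(\mathbb{Z}/m\mathbb{Z})^\times$, where $\langle x\rangle_m$ is the representative of $x$ modulo $m$ in $\{0,\dots,m-1\}$. -}

module Defs where

open import Data.Nat using (ℕ; zero; suc; _+_; _*_; _∸_; _≤_; _<_; NonZero)
open import Data.Nat.DivMod using (_%_)
open import Data.Nat.Divisibility using (_∣_)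
open import Data.Nat.GCD using (gcd)
open import Data.Fin using (Fin; toℕ)
open import Data.Vec.Functional using (Vector; foldr)
open import Relation.Binary.PropositionalEquality using (_≡_)

sumV : ∀ {n} → Vector ℕ n → ℕ
sumV = foldr _+_ 0

-- β ∈ 𝔅_m^d, with β given as b : Fin (2d) → ℕ, where b i (i = 0..2d-1) is b_{i+1}.
-- ⟨x⟩_m = x % m; condition (3) is stated multiplied by m (sum of ⟨t b_i⟩_m = d*m),
-- t ranging over representatives 1 ≤ t < m with gcd t m = 1 of (ℤ/mℤ)^×.
record InB (m d : ℕ) .{{_ : NonZero m}} (b : Vector ℕ (2 * d)) : Set where
  field
    lower   : ∀ i → 1 ≤ b i
    upper   : ∀ i → b i ≤ m ∸ 1
    incr    : ∀ (i j : Fin (2 * d)) → toℕ i < toℕ j → b i < b j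
    sumCong : m ∣ sumV b
    units   : ∀ t → 1 ≤ t → t < m → gcd t m ≡ 1 →
              sumV (λ i → (t * b i) % m) ≡ d * m

open import Data.Product using (∃)

Odd : ℕ → Set
Odd m = ∃ λ k → m ≡ suc (2 * k)

-- the Fin (2d) index of b_d (i.e. position d-1) and of b_{d+1} (position d), for d ≥ 1
open import Data.Fin using (fromℕ<)
open import Data.Nat using (s≤s; z≤n)

idx-d : ∀ k → Fin (2 * suc k)
idx-d k = fromℕ< {k} (lt k)
  where
  open import Data.Nat.Properties using (m≤m+n; +-suc)
  open import Relation.Binary.PropositionalEquality using (subst; sym)
  lt : ∀ k → k < 2 * suc k
  lt k = s≤s (m≤m+n k (suc (k + 0)))

idx-d+1 : ∀ k → Fin (2 * suc k)
idx-d+1 k = fromℕ< {suc k} (lt k)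
  where
  open import Data.Nat.Properties using (m≤m+n; +-suc)
  lt : ∀ k → suc k < 2 * suc k
  lt k = s≤s (subst-help k)
    where
    open import Relation.Binary.PropositionalEquality using (subst; sym)
    subst-help : ∀ k → suc k ≤ k + suc (k + 0)
    subst-help k = subst (suc k ≤_) (sym (+-suc k (k + 0))) (s≤s (m≤m+n k (k + 0)))

{-# OPTIONS --safe #-}
module Submission where

-- Taking t = 1 in the unit condition gives Σ b_i = d m, and taking t = 2 (a unit, m being odd)
-- gives Σ ⟨2 b_i⟩_m = d m. As ⟨2 b_i⟩_m = 2 b_i − m ⌊2 b_i / m⌋ with ⌊2 b_i / m⌋ ∈ {0, 1},
-- exactly d of the 2d entries satisfy 2 b_i ≥ m, and by parity 2 b_i ≠ m. Since β is
-- increasing, these are the last d entries b_{d+1}, …, b_{2d}.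

open import Defs
open import Data.Nat using (ℕ; zero; suc; _+_; _*_; _∸_; _≤_; _<_; _>_; NonZero; z≤n; s≤s; z<s; s≤s⁻¹; _≤?_; _<?_)
open import Data.Nat.Properties
open import Data.Nat.DivMod using (_%_; _/_; m≡m%n+[m/n]*n; m<n⇒m%n≡m; m<n⇒m/n≡0; m≥n⇒m/n>0; m<n*o⇒m/o<n)
open import Data.Nat.Divisibility using (_∣_; divides)
open import Data.Nat.GCD using (gcd)
open import Data.Nat.Coprimality using (coprime⇒gcd≡1; 1-coprimeTo)
open import Data.Nat.Primality using (irreducible[2])
open import Data.Fin using (toℕ) renaming (zero to fzero; suc to fsuc)
open import Data.Fin.Properties using (toℕ<n; toℕ-fromℕ<; toℕ-injective)
open import Data.Vec.Functional using (Vector; tail)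
open import Function using (_∘_)
open import Data.Product using (_×_; _,_)
open import Data.Sum using (inj₁; inj₂)
open import Relation.Nullary using (yes; no; contradiction)
open import Relation.Binary.PropositionalEquality
open import Algebra.Properties.Semiring.Sum +-*-semiring using (sum-cong-≗; ∑-distrib-+; *-distribˡ-sum; *-distribʳ-sum)

sumV-divMod : ∀ {n} m .{{_ : NonZero m}} (x : Vector ℕ n) →
  sumV x ≡ sumV (λ i → x i % m) + sumV (λ i → x i / m) * m
sumV-divMod m x = begin
  sumV x                                              ≡⟨ sum-cong-≗ (λ i → m≡m%n+[m/n]*n (x i) m) ⟩
  sumV (λ i → x i % m + x i / m * m)                  ≡⟨ ∑-distrib-+ (λ i → x i % m) (λ i → x i / m * m) ⟩
  sumV (λ i → x i % m) + sumV (λ i → x i / m * m)     ≡⟨ cong (sumV (λ i → x i % m) +_) (*-distribʳ-sum m (λ i → x i / m)) ⟨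
  sumV (λ i → x i % m) + sumV (λ i → x i / m) * m     ∎
  where open ≡-Reasoning

n≤p+sumV : ∀ {n} (c : Vector ℕ n) p → (∀ j → p ≤ toℕ j → 1 ≤ c j) → n ≤ p + sumV c
n≤p+sumV {zero}  c p       _   = z≤n
n≤p+sumV {suc n} c zero    c≥1 = +-mono-≤ (c≥1 fzero z≤n) (n≤p+sumV (tail c) zero (λ j _ → c≥1 (fsuc j) z≤n))
n≤p+sumV {suc n} c (suc p) c≥1 = s≤s (≤-trans (n≤p+sumV (tail c) p (λ j p≤j → c≥1 (fsuc j) (s≤s p≤j)))
                                              (+-monoʳ-≤ p (m≤n+m (sumV (tail c)) (c fzero))))

p+sumV≤n : ∀ {n} (c : Vector ℕ n) p → p ≤ n → (∀ j → c j ≤ 1) → (∀ j → toℕ j < p → c j ≡ 0) → p + sumV c ≤ n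
p+sumV≤n {zero}  c zero    _         _   _   = z≤n
p+sumV≤n {suc n} c zero    _         c≤1 _   = +-mono-≤ (c≤1 fzero) (p+sumV≤n (tail c) zero z≤n (c≤1 ∘ fsuc) (λ _ ()))
p+sumV≤n {suc n} c (suc p) (s≤s p≤n) c≤1 c≡0 rewrite c≡0 fzero (s≤s z≤n) =
  s≤s (p+sumV≤n (tail c) p p≤n (c≤1 ∘ fsuc) (λ j j<p → c≡0 (fsuc j) (s≤s j<p)))

strictMono⇒mono : ∀ {n} (b : Vector ℕ n) → (∀ i j → toℕ i < toℕ j → b i < b j) →
  ∀ i j → toℕ i ≤ toℕ j → b i ≤ b j
strictMono⇒mono b b-strict i j i≤j with m≤n⇒m<n∨m≡n i≤j
... | inj₁ i<j = <⇒≤ (b-strict i j i<j)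
... | inj₂ i≡j = ≤-reflexive (cong b (toℕ-injective i≡j))

odd⇒gcd[2,m]≡1 : ∀ {m} → Odd m → gcd 2 m ≡ 1
odd⇒gcd[2,m]≡1 {m} (h , refl) = coprime⇒gcd≡1 coprime
  where
  coprime : ∀ {e} → e ∣ 2 × e ∣ m → e ≡ 1
  coprime (e∣2 , e∣m) with irreducible[2] e∣2
  ... | inj₁ e≡1 = e≡1
  ... | inj₂ refl with e∣m
  ...   | divides q m≡q*2 = contradiction (trans (*-comm 2 q) (sym m≡q*2)) (even≢odd q h)

-- Counts the i with m ≤ 2 * b i only when all b i < m, each summand then being 0 or 1.
#aboveHalf : ∀ {n} m .{{_ : NonZero m}} → Vector ℕ n → ℕ
#aboveHalf m b = sumV (λ i → 2 * b i / m)

module _ {n m} .{{_ : NonZero m}} (b : Vector ℕ n)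
         (b-mono : ∀ i j → toℕ i ≤ toℕ j → b i ≤ b j) where

  j+#aboveHalf<n⇒2b<m : ∀ j → toℕ j + #aboveHalf m b < n → 2 * b j < m
  j+#aboveHalf<n⇒2b<m j j+#<n with m ≤? 2 * b j
  ... | no  m≰2b = ≰⇒> m≰2b
  ... | yes m≤2b = contradiction (n≤p+sumV _ (toℕ j) above) (<⇒≱ j+#<n)
    where
    above : ∀ i → toℕ j ≤ toℕ i → 1 ≤ 2 * b i / m
    above i j≤i = m≥n⇒m/n>0 (≤-trans m≤2b (*-monoʳ-≤ 2 (b-mono j i j≤i)))

  n≤j+#aboveHalf⇒m<2b : (∀ i → b i < m) → Odd m → ∀ j → n ≤ toℕ j + #aboveHalf m b → m < 2 * b j
  n≤j+#aboveHalf⇒m<2b b<m (h , m≡1+2h) j n≤j+# with m <? 2 * b j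
  ... | yes m<2b = m<2b
  ... | no  m≮2b = contradiction n≤j+# (<⇒≱ (p+sumV≤n _ (suc (toℕ j)) (toℕ<n j) 2b/m≤1 below))
    where
    2b<m : 2 * b j < m
    2b<m = ≤∧≢⇒< (≮⇒≥ m≮2b) (λ 2b≡m → even≢odd (b j) h (trans 2b≡m m≡1+2h))
    2b/m≤1 : ∀ i → 2 * b i / m ≤ 1
    2b/m≤1 i = s≤s⁻¹ (m<n*o⇒m/o<n (*-monoʳ-< 2 (b<m i)))
    below : ∀ i → toℕ i < suc (toℕ j) → 2 * b i / m ≡ 0
    below i i<1+j = m<n⇒m/n≡0 (≤-<-trans (*-monoʳ-≤ 2 (b-mono i j (s≤s⁻¹ i<1+j))) 2b<m)

m∸1<m : ∀ m .{{_ : NonZero m}} → m ∸ 1 < m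
m∸1<m (suc m) = ≤-refl

module _ {m d} .{{_ : NonZero m}} {b : Vector ℕ (2 * d)} (β : InB m d b) where
  open InB β

  InB⇒b<m : ∀ i → b i < m
  InB⇒b<m i = ≤-<-trans (upper i) (m∸1<m m)

  InB⇒sumV≡d*m : 1 < m → sumV b ≡ d * m
  InB⇒sumV≡d*m 1<m = trans (sum-cong-≗ 1*b%m≡b) (units 1 ≤-refl 1<m (coprime⇒gcd≡1 (1-coprimeTo m)))
    where
    1*b%m≡b : ∀ i → b i ≡ 1 * b i % m
    1*b%m≡b i = sym (trans (cong (_% m) (*-identityˡ (b i))) (m<n⇒m%n≡m (InB⇒b<m i)))

  InB⇒d+sumV[tb/m]≡t*d : ∀ t → 1 ≤ t → t < m → gcd t m ≡ 1 → d + sumV (λ i → t * b i / m) ≡ t * d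
  InB⇒d+sumV[tb/m]≡t*d t 1≤t t<m gcd≡1 = *-cancelʳ-≡ _ _ m (begin
    (d + S) * m                          ≡⟨ *-distribʳ-+ m d S ⟩
    d * m + S * m                        ≡⟨ cong (_+ S * m) (units t 1≤t t<m gcd≡1) ⟨
    sumV (λ i → t * b i % m) + S * m     ≡⟨ sumV-divMod m (λ i → t * b i) ⟨
    sumV (λ i → t * b i)                 ≡⟨ *-distribˡ-sum t b ⟨
    t * sumV b                           ≡⟨ cong (t *_) (InB⇒sumV≡d*m (≤-<-trans 1≤t t<m)) ⟩
    t * (d * m)                          ≡⟨ *-assoc t d m ⟨
    t * d * m                            ∎)
    where
    open ≡-Reasoning
    S : ℕ
    S = sumV (λ i → t * b i / m)

  InB⇒#aboveHalf≡d : 2 < m → Odd m → #aboveHalf m b ≡ d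
  InB⇒#aboveHalf≡d 2<m odd = +-cancelˡ-≡ d _ _ (begin
    d + #aboveHalf m b    ≡⟨ InB⇒d+sumV[tb/m]≡t*d 2 (s≤s z≤n) 2<m (odd⇒gcd[2,m]≡1 odd) ⟩
    2 * d                 ≡⟨ cong (d +_) (+-identityʳ d) ⟩
    d + d                 ∎)
    where open ≡-Reasoning

lemma3p10 : ∀ (m k : ℕ) .{{_ : NonZero m}} → Odd m → 2 * suc k ≤ m ∸ 1 →
    (b : Vector ℕ (2 * suc k)) → InB m (suc k) b →
    (2 * b (idx-d k) < m) × (2 * b (idx-d+1 k) > m)
lemma3p10 m k odd 2d≤m∸1 b β =
    j+#aboveHalf<n⇒2b<m b b-mono (idx-d k) d-1+#<2d
  , n≤j+#aboveHalf⇒m<2b b b-mono (InB⇒b<m β) odd (idx-d+1 k) 2d≤d+#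
  where
  open ≤-Reasoning
  d : ℕ
  d = suc k
  b-mono : ∀ i j → toℕ i ≤ toℕ j → b i ≤ b j
  b-mono = strictMono⇒mono b (InB.incr β)
  #≡d : #aboveHalf m b ≡ d
  #≡d = InB⇒#aboveHalf≡d β (≤-<-trans (≤-trans (*-monoʳ-≤ 2 (s≤s z≤n)) 2d≤m∸1) (m∸1<m m)) odd
  2d≡d+d : 2 * d ≡ d + d
  2d≡d+d = cong (d +_) (+-identityʳ d)
  d-1+#<2d : toℕ (idx-d k) + #aboveHalf m b < 2 * d
  d-1+#<2d = begin-strict
    toℕ (idx-d k) + #aboveHalf m b  ≡⟨ cong₂ _+_ (toℕ-fromℕ< _) #≡d ⟩
    k + d                           <⟨ +-monoˡ-< d (n<1+n k) ⟩
    d + d                           ≡⟨ 2d≡d+d ⟨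
    2 * d                           ∎
  2d≤d+# : 2 * d ≤ toℕ (idx-d+1 k) + #aboveHalf m b
  2d≤d+# = ≤-reflexive (trans 2d≡d+d (cong₂ _+_ (sym (toℕ-fromℕ< (m<m+n d z<s))) (sym #≡d)))
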